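{- An elliptic curve $E/\mathbb{Q}$ has additive reduction at $2$ if and only if $\operatorname{rmm}(E)\in\{R_1,R_3,R_5\}$, where $R_1=(0,0,0)$, $R_3=(0,-1,0)$, $R_5=(0,1,0)$.
   Context: A global minimal model of $E/\mathbb{Q}$ is an integral Weierstrass model $y^2+a_1xy+a_3y=x^3+a_2x^2+a_4x+a_6$, $\mathbb{Q}$-isomorphic to $E$, whose discriminant $\Delta$ has minimal absolute value; with $c_4=a_1^4+8a_1^2a_2-24a_1a_3+16a_2^2-48a_4$ its invariant, $E$ has additive reduction at a prime $p$ if $p\mid\gcd(c_4,\Delta)$. The reduced minimal model of $E$ is the unique global minimal model with $a_1,a_3\in\{0,1\}$ and $a_2\in\{ -1,0,1\}$, and $\operatorname{rmm}(E)=(a_1,a_2,a_3)$ denotes its coefficients. -}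

module Defs where

open import Data.Nat using (ℕ)
open import Data.Integer using (ℤ; +_)
import Data.Integer as ℤ
open import Data.Rational using (ℚ; _/_; _+_; _*_; _-_; -_; ∣_∣; _≤_)
open import Data.Product using (Σ; _×_; ∃)
open import Data.Sum using (_⊎_)
open import Relation.Binary.PropositionalEquality using (_≡_)
open import Relation.Nullary using (¬_)

κ : ℕ → ℚ
κ n = + n / 1

ι : ℤ → ℚ
ι z = z / 1

-- a (long) Weierstrass equation y^2 + a1 xy + a3 y = x^3 + a2 x^2 + a4 x + a6
-- with rational coefficients
record Weierstrass : Set where
  constructor mkW
  field
    a1 a2 a3 a4 a6 : ℚ
open Weierstrass public

module _ (W : Weierstrass) where
  b2 b4 b6 b8 : ℚ
  b2 = a1 W * a1 W + κ 4 * a2 W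
  b4 = κ 2 * a4 W + a1 W * a3 W
  b6 = a3 W * a3 W + κ 4 * a6 W
  b8 = a1 W * a1 W * a6 W + κ 4 * a2 W * a6 W - a1 W * a3 W * a4 W
       + a2 W * a3 W * a3 W - a4 W * a4 W

  c4 : ℚ
  c4 = a1 W * a1 W * a1 W * a1 W + κ 8 * a1 W * a1 W * a2 W
       - κ 24 * a1 W * a3 W + κ 16 * a2 W * a2 W - κ 48 * a4 W

  disc : ℚ
  disc = - (b2 * b2 * b8) - κ 8 * b4 * b4 * b4 - κ 27 * b6 * b6
         + κ 9 * b2 * b4 * b6

record EllipticCurve : Set where
  constructor mkE
  field
    eqn    : Weierstrass
    nonsing : ¬ (disc eqn ≡ κ 0)
open EllipticCurve public

-- W' is obtained from W by the admissible change of variables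
-- x = u^2 x' + r, y = u^3 y' + s u^2 x' + t  (u,r,s,t ∈ ℚ, u ≠ 0)
IsoQ : Weierstrass → Weierstrass → Set
IsoQ W W' = Σ ℚ λ u → Σ ℚ λ r → Σ ℚ λ s → Σ ℚ λ t →
  ¬ (u ≡ κ 0) ×
  (u * a1 W' ≡ a1 W + κ 2 * s) ×
  (u * u * a2 W' ≡ a2 W - s * a1 W + κ 3 * r - s * s) ×
  (u * u * u * a3 W' ≡ a3 W + r * a1 W + κ 2 * t) ×
  (u * u * u * u * a4 W' ≡ a4 W - s * a3 W + κ 2 * r * a2 W
                             - (t + r * s) * a1 W + κ 3 * r * r - κ 2 * s * t) ×
  (u * u * u * u * u * u * a6 W' ≡ a6 W + r * a4 W + r * r * a2 W + r * r * r
                                     - t * a3 W - t * t - r * t * a1 W)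

IsInt : ℚ → Set
IsInt q = Σ ℤ λ z → q ≡ ι z

Integral : Weierstrass → Set
Integral W = IsInt (a1 W) × IsInt (a2 W) × IsInt (a3 W) × IsInt (a4 W) × IsInt (a6 W)

GlobalMinimal : EllipticCurve → Weierstrass → Set
GlobalMinimal E M =
  Integral M × IsoQ (eqn E) M ×
  ((M' : Weierstrass) → Integral M' → IsoQ (eqn E) M' → ∣ disc M ∣ ≤ ∣ disc M' ∣)

-- M is the reduced minimal model of E (unique, so M = rmm(E))
ReducedMinimal : EllipticCurve → Weierstrass → Set
ReducedMinimal E M =
  GlobalMinimal E M ×
  (a1 M ≡ κ 0 ⊎ a1 M ≡ κ 1) ×
  (a3 M ≡ κ 0 ⊎ a3 M ≡ κ 1) ×
  (a2 M ≡ - κ 1 ⊎ a2 M ≡ κ 0 ⊎ a2 M ≡ κ 1)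

_∣ℚ_ : ℕ → ℚ → Set
p ∣ℚ q = Σ ℤ λ k → q ≡ ι (+ p ℤ.* k)

AdditiveAt : ℕ → EllipticCurve → Set
AdditiveAt p E = Σ Weierstrass λ M → GlobalMinimal E M × (p ∣ℚ c4 M) × (p ∣ℚ disc M)

-- rmm(M) = (a1, a2, a3) equals (x, y, z)
RmmIs : Weierstrass → ℚ → ℚ → ℚ → Set
RmmIs M x y z = (a1 M ≡ x) × (a2 M ≡ y) × (a3 M ≡ z)

-- Under an admissible change of variables with scaling factor u, c4 and Δ are
-- multiplied by u⁴ and u¹².  Two global minimal models of E have discriminants of
-- the same absolute value, which forces u¹² = v¹², hence u⁴ = v⁴, so they have the
-- same c4 and Δ: additive reduction at 2 can be read off the reduced minimal model.
-- There a₁ = 1 makes c4 odd and a₁ = 0, a₃ = 1 makes Δ odd, while a₁ = a₃ = 0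
-- makes both c4 and Δ even.
module Submission where

open import Defs
open import Data.Rational using (-_)
open import Data.Product using (_×_)
open import Data.Sum using (_⊎_)

open import Data.Empty using (⊥-elim)
open import Data.Integer as ℤ using (+_; +0; +[1+_]; -[1+_])
import Data.Integer.Properties as ℤ
open import Data.Integer.Tactic.RingSolver using () renaming (solve-∀ to ℤ-solve-∀)
open import Data.Integer.Divisibility.Signed using (_∣_; divides; ∣m+n∣n⇒∣m; ∣⇒∣ᵤ)
open import Data.Maybe using (Maybe; just; nothing)
open import Data.Nat.Divisibility using (∣1⇒≡1)
open import Data.Product using (_,_; proj₁; proj₂; uncurry)
open import Data.Rational using (ℚ; mkℚ; _+_; _*_; _-_; 0ℚ; 1ℚ; ∣_∣; _<_; Positive; toℚᵘ; 1/_; ≢-nonZero)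
open import Data.Rational.Properties
import Data.Rational.Unnormalised as ℚᵘ
import Data.Rational.Unnormalised.Properties as ℚᵘ
open import Data.Sum using (inj₁; inj₂)
open import Function using (_∘_)
open import Relation.Binary.Definitions using (tri<; tri≈; tri>)
open import Relation.Binary.PropositionalEquality
open import Relation.Nullary using (¬_; yes; no)
open import Tactic.RingSolver using (solve-∀)
open import Tactic.RingSolver.Core.AlmostCommutativeRing

ℚ-ring : AlmostCommutativeRing _ _
ℚ-ring = fromCommutativeRing +-*-commutativeRing isZero
  where
  isZero : ∀ x → Maybe (0ℚ ≡ x)
  isZero x with 0ℚ ≟ x
  ... | yes 0≡x = just 0≡x
  ... | no _    = nothing

open AlmostCommutativeRing ℚ-ring using (_^_)

scale : ℚ → Weierstrass → Weierstrass
scale u W = mkW (u * a1 W) (u * u * a2 W) (u * u * u * a3 W)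
                (u * u * u * u * a4 W) (u * u * u * u * u * u * a6 W)

-- IsoQ W W′ says precisely that scale u W′ ≡ translate r s t W.
translate : ℚ → ℚ → ℚ → Weierstrass → Weierstrass
translate r s t W = mkW
  (a1 W + κ 2 * s)
  (a2 W - s * a1 W + κ 3 * r - s * s)
  (a3 W + r * a1 W + κ 2 * t)
  (a4 W - s * a3 W + κ 2 * r * a2 W - (t + r * s) * a1 W + κ 3 * r * r - κ 2 * s * t)
  (a6 W + r * a4 W + r * r * a2 W + r * r * r - t * a3 W - t * t - r * t * a1 W)

-- disc W unfolds to discᵇ (b2 W) (b4 W) (b6 W) (b8 W).  The ring solver treats
-- defined names (c4, b2, discᵇ, ...) as constants, so each polynomial identity
-- below is solved in a local lemma on the unfolded polynomials and then used at
-- the definitionally equal statement.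
discᵇ : ℚ → ℚ → ℚ → ℚ → ℚ
discᵇ b₂ b₄ b₆ b₈ = - (b₂ * b₂ * b₈) - κ 8 * b₄ * b₄ * b₄ - κ 27 * b₆ * b₆ + κ 9 * b₂ * b₄ * b₆

discᵇ-cong : ∀ {b₂ b₄ b₆ b₈ b₂′ b₄′ b₆′ b₈′} → b₂ ≡ b₂′ → b₄ ≡ b₄′ → b₆ ≡ b₆′ → b₈ ≡ b₈′ →
  discᵇ b₂ b₄ b₆ b₈ ≡ discᵇ b₂′ b₄′ b₆′ b₈′
discᵇ-cong refl refl refl refl = refl

discᵇ-scale : ∀ u b₂ b₄ b₆ b₈ →
  discᵇ (u ^ 2 * b₂) (u ^ 4 * b₄) (u ^ 6 * b₆) (u ^ 8 * b₈) ≡ u ^ 12 * discᵇ b₂ b₄ b₆ b₈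
discᵇ-scale = lemma
  where
  lemma : ∀ u b₂ b₄ b₆ b₈ →
    let Δ = λ b₂ b₄ b₆ b₈ → - (b₂ * b₂ * b₈) - κ 8 * b₄ * b₄ * b₄ - κ 27 * b₆ * b₆ + κ 9 * b₂ * b₄ * b₆
    in Δ (u ^ 2 * b₂) (u ^ 4 * b₄) (u ^ 6 * b₆) (u ^ 8 * b₈) ≡ u ^ 12 * Δ b₂ b₄ b₆ b₈
  lemma = solve-∀ ℚ-ring

discᵇ-shift : ∀ r b₂ b₄ b₆ b₈ → b₂ * b₆ - b₄ * b₄ ≡ κ 4 * b₈ →
  discᵇ (b₂ + κ 12 * r) (b₄ + r * b₂ + κ 6 * r * r) (b₆ + κ 2 * r * b₄ + r * r * b₂ + κ 4 * r * r * r)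
        (b₈ + κ 3 * r * b₆ + κ 3 * r * r * b₄ + r * r * r * b₂ + κ 3 * r * r * r * r)
  ≡ discᵇ b₂ b₄ b₆ b₈
discᵇ-shift r b₂ b₄ b₆ b₈ rel = trans (identity r b₂ b₄ b₆ b₈) (begin
  discᵇ b₂ b₄ b₆ b₈ + K * (b₂ * b₆ - b₄ * b₄ - κ 4 * b₈)  ≡⟨ cong (λ x → discᵇ b₂ b₄ b₆ b₈ + K * x) rel′ ⟩
  discᵇ b₂ b₄ b₆ b₈ + K * 0ℚ                              ≡⟨ cong (_+_ (discᵇ b₂ b₄ b₆ b₈)) (*-zeroʳ K) ⟩
  discᵇ b₂ b₄ b₆ b₈ + 0ℚ                                  ≡⟨ +-identityʳ (discᵇ b₂ b₄ b₆ b₈) ⟩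
  discᵇ b₂ b₄ b₆ b₈                                       ∎)
  where
  open ≡-Reasoning
  K : ℚ
  K = κ 6 * r * b₂ + κ 36 * r * r
  rel′ : b₂ * b₆ - b₄ * b₄ - κ 4 * b₈ ≡ 0ℚ
  rel′ = trans (cong (_- κ 4 * b₈) rel) (+-inverseʳ (κ 4 * b₈))
  identity : ∀ r b₂ b₄ b₆ b₈ →
    let Δ = λ b₂ b₄ b₆ b₈ → - (b₂ * b₂ * b₈) - κ 8 * b₄ * b₄ * b₄ - κ 27 * b₆ * b₆ + κ 9 * b₂ * b₄ * b₆
    in Δ (b₂ + κ 12 * r) (b₄ + r * b₂ + κ 6 * r * r) (b₆ + κ 2 * r * b₄ + r * r * b₂ + κ 4 * r * r * r)
         (b₈ + κ 3 * r * b₆ + κ 3 * r * r * b₄ + r * r * r * b₂ + κ 3 * r * r * r * r)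
       ≡ Δ b₂ b₄ b₆ b₈ + (κ 6 * r * b₂ + κ 36 * r * r) * (b₂ * b₆ - b₄ * b₄ - κ 4 * b₈)
  identity = solve-∀ ℚ-ring

c4-scale : ∀ u W → c4 (scale u W) ≡ u ^ 4 * c4 W
c4-scale u W = lemma u (a1 W) (a2 W) (a3 W) (a4 W)
  where
  lemma : ∀ u x₁ x₂ x₃ x₄ →
    let γ = λ x₁ x₂ x₃ x₄ → x₁ * x₁ * x₁ * x₁ + κ 8 * x₁ * x₁ * x₂ - κ 24 * x₁ * x₃ + κ 16 * x₂ * x₂ - κ 48 * x₄
    in γ (u * x₁) (u * u * x₂) (u * u * u * x₃) (u * u * u * u * x₄) ≡ u ^ 4 * γ x₁ x₂ x₃ x₄
  lemma = solve-∀ ℚ-ring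

b2-scale : ∀ u W → b2 (scale u W) ≡ u ^ 2 * b2 W
b2-scale u W = lemma u (a1 W) (a2 W)
  where
  lemma : ∀ u x₁ x₂ → (u * x₁) * (u * x₁) + κ 4 * (u * u * x₂) ≡ u ^ 2 * (x₁ * x₁ + κ 4 * x₂)
  lemma = solve-∀ ℚ-ring

b4-scale : ∀ u W → b4 (scale u W) ≡ u ^ 4 * b4 W
b4-scale u W = lemma u (a1 W) (a3 W) (a4 W)
  where
  lemma : ∀ u x₁ x₃ x₄ → κ 2 * (u * u * u * u * x₄) + (u * x₁) * (u * u * u * x₃) ≡ u ^ 4 * (κ 2 * x₄ + x₁ * x₃)
  lemma = solve-∀ ℚ-ring

b6-scale : ∀ u W → b6 (scale u W) ≡ u ^ 6 * b6 W
b6-scale u W = lemma u (a3 W) (a6 W)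
  where
  lemma : ∀ u x₃ x₆ →
    (u * u * u * x₃) * (u * u * u * x₃) + κ 4 * (u * u * u * u * u * u * x₆) ≡ u ^ 6 * (x₃ * x₃ + κ 4 * x₆)
  lemma = solve-∀ ℚ-ring

b8-scale : ∀ u W → b8 (scale u W) ≡ u ^ 8 * b8 W
b8-scale u W = lemma u (a1 W) (a2 W) (a3 W) (a4 W) (a6 W)
  where
  lemma : ∀ u x₁ x₂ x₃ x₄ x₆ →
    let β = λ x₁ x₂ x₃ x₄ x₆ → x₁ * x₁ * x₆ + κ 4 * x₂ * x₆ - x₁ * x₃ * x₄ + x₂ * x₃ * x₃ - x₄ * x₄
    in β (u * x₁) (u * u * x₂) (u * u * u * x₃) (u * u * u * u * x₄) (u * u * u * u * u * u * x₆)
       ≡ u ^ 8 * β x₁ x₂ x₃ x₄ x₆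
  lemma = solve-∀ ℚ-ring

disc-scale : ∀ u W → disc (scale u W) ≡ u ^ 12 * disc W
disc-scale u W = trans (discᵇ-cong (b2-scale u W) (b4-scale u W) (b6-scale u W) (b8-scale u W))
                       (discᵇ-scale u (b2 W) (b4 W) (b6 W) (b8 W))

c4-translate : ∀ r s t W → c4 (translate r s t W) ≡ c4 W
c4-translate r s t W = lemma r s t (a1 W) (a2 W) (a3 W) (a4 W)
  where
  lemma : ∀ r s t x₁ x₂ x₃ x₄ →
    let γ = λ x₁ x₂ x₃ x₄ → x₁ * x₁ * x₁ * x₁ + κ 8 * x₁ * x₁ * x₂ - κ 24 * x₁ * x₃ + κ 16 * x₂ * x₂ - κ 48 * x₄
    in γ (x₁ + κ 2 * s) (x₂ - s * x₁ + κ 3 * r - s * s) (x₃ + r * x₁ + κ 2 * t)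
         (x₄ - s * x₃ + κ 2 * r * x₂ - (t + r * s) * x₁ + κ 3 * r * r - κ 2 * s * t)
       ≡ γ x₁ x₂ x₃ x₄
  lemma = solve-∀ ℚ-ring

b2-translate : ∀ r s t W → b2 (translate r s t W) ≡ b2 W + κ 12 * r
b2-translate r s t W = lemma r s (a1 W) (a2 W)
  where
  lemma : ∀ r s x₁ x₂ →
    let y₁ = x₁ + κ 2 * s
        y₂ = x₂ - s * x₁ + κ 3 * r - s * s
    in y₁ * y₁ + κ 4 * y₂ ≡ (x₁ * x₁ + κ 4 * x₂) + κ 12 * r
  lemma = solve-∀ ℚ-ring

b4-translate : ∀ r s t W → b4 (translate r s t W) ≡ b4 W + r * b2 W + κ 6 * r * r
b4-translate r s t W = lemma r s t (a1 W) (a2 W) (a3 W) (a4 W)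
  where
  lemma : ∀ r s t x₁ x₂ x₃ x₄ →
    let y₁ = x₁ + κ 2 * s
        y₃ = x₃ + r * x₁ + κ 2 * t
        y₄ = x₄ - s * x₃ + κ 2 * r * x₂ - (t + r * s) * x₁ + κ 3 * r * r - κ 2 * s * t
    in κ 2 * y₄ + y₁ * y₃ ≡ (κ 2 * x₄ + x₁ * x₃) + r * (x₁ * x₁ + κ 4 * x₂) + κ 6 * r * r
  lemma = solve-∀ ℚ-ring

b6-translate : ∀ r s t W → b6 (translate r s t W) ≡ b6 W + κ 2 * r * b4 W + r * r * b2 W + κ 4 * r * r * r
b6-translate r s t W = lemma r t (a1 W) (a2 W) (a3 W) (a4 W) (a6 W)
  where
  lemma : ∀ r t x₁ x₂ x₃ x₄ x₆ →
    let y₃ = x₃ + r * x₁ + κ 2 * t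
        y₆ = x₆ + r * x₄ + r * r * x₂ + r * r * r - t * x₃ - t * t - r * t * x₁
    in y₃ * y₃ + κ 4 * y₆
       ≡ (x₃ * x₃ + κ 4 * x₆) + κ 2 * r * (κ 2 * x₄ + x₁ * x₃) + r * r * (x₁ * x₁ + κ 4 * x₂) + κ 4 * r * r * r
  lemma = solve-∀ ℚ-ring

b8-translate : ∀ r s t W → b8 (translate r s t W) ≡
  b8 W + κ 3 * r * b6 W + κ 3 * r * r * b4 W + r * r * r * b2 W + κ 3 * r * r * r * r
b8-translate r s t W = lemma r s t (a1 W) (a2 W) (a3 W) (a4 W) (a6 W)
  where
  lemma : ∀ r s t x₁ x₂ x₃ x₄ x₆ →
    let y₁ = x₁ + κ 2 * s
        y₂ = x₂ - s * x₁ + κ 3 * r - s * s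
        y₃ = x₃ + r * x₁ + κ 2 * t
        y₄ = x₄ - s * x₃ + κ 2 * r * x₂ - (t + r * s) * x₁ + κ 3 * r * r - κ 2 * s * t
        y₆ = x₆ + r * x₄ + r * r * x₂ + r * r * r - t * x₃ - t * t - r * t * x₁
    in y₁ * y₁ * y₆ + κ 4 * y₂ * y₆ - y₁ * y₃ * y₄ + y₂ * y₃ * y₃ - y₄ * y₄
       ≡ (x₁ * x₁ * x₆ + κ 4 * x₂ * x₆ - x₁ * x₃ * x₄ + x₂ * x₃ * x₃ - x₄ * x₄)
         + κ 3 * r * (x₃ * x₃ + κ 4 * x₆) + κ 3 * r * r * (κ 2 * x₄ + x₁ * x₃)
         + r * r * r * (x₁ * x₁ + κ 4 * x₂) + κ 3 * r * r * r * r
  lemma = solve-∀ ℚ-ring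

b-relation : ∀ W → b2 W * b6 W - b4 W * b4 W ≡ κ 4 * b8 W
b-relation W = lemma (a1 W) (a2 W) (a3 W) (a4 W) (a6 W)
  where
  lemma : ∀ x₁ x₂ x₃ x₄ x₆ →
    (x₁ * x₁ + κ 4 * x₂) * (x₃ * x₃ + κ 4 * x₆) - (κ 2 * x₄ + x₁ * x₃) * (κ 2 * x₄ + x₁ * x₃)
    ≡ κ 4 * (x₁ * x₁ * x₆ + κ 4 * x₂ * x₆ - x₁ * x₃ * x₄ + x₂ * x₃ * x₃ - x₄ * x₄)
  lemma = solve-∀ ℚ-ring

disc-translate : ∀ r s t W → disc (translate r s t W) ≡ disc W
disc-translate r s t W =
  trans (discᵇ-cong (b2-translate r s t W) (b4-translate r s t W) (b6-translate r s t W) (b8-translate r s t W))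
        (discᵇ-shift r (b2 W) (b4 W) (b6 W) (b8 W) (b-relation W))

mkW-cong : ∀ {x₁ x₂ x₃ x₄ x₆ y₁ y₂ y₃ y₄ y₆} →
  x₁ ≡ y₁ → x₂ ≡ y₂ → x₃ ≡ y₃ → x₄ ≡ y₄ → x₆ ≡ y₆ → mkW x₁ x₂ x₃ x₄ x₆ ≡ mkW y₁ y₂ y₃ y₄ y₆
mkW-cong refl refl refl refl refl = refl

record ScaledInvariants (W W′ : Weierstrass) : Set where
  field
    u            : ℚ
    u≢0          : ¬ (u ≡ 0ℚ)
    c4-scaled    : u ^ 4 * c4 W′ ≡ c4 W
    disc-scaled  : u ^ 12 * disc W′ ≡ disc W

isoQ⇒scaledInvariants : ∀ {W W′} → IsoQ W W′ → ScaledInvariants W W′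
isoQ⇒scaledInvariants {W} {W′} (u , r , s , t , u≢0 , e₁ , e₂ , e₃ , e₄ , e₆) =
  record { u = u ; u≢0 = u≢0 ; c4-scaled = c4-eq ; disc-scaled = disc-eq }
  where
  open ≡-Reasoning
  W′ᵘ≡Wʳˢᵗ : scale u W′ ≡ translate r s t W
  W′ᵘ≡Wʳˢᵗ = mkW-cong e₁ e₂ e₃ e₄ e₆
  c4-eq : u ^ 4 * c4 W′ ≡ c4 W
  c4-eq = begin
    u ^ 4 * c4 W′           ≡⟨ c4-scale u W′ ⟨
    c4 (scale u W′)         ≡⟨ cong c4 W′ᵘ≡Wʳˢᵗ ⟩
    c4 (translate r s t W)  ≡⟨ c4-translate r s t W ⟩
    c4 W                    ∎
  disc-eq : u ^ 12 * disc W′ ≡ disc W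
  disc-eq = begin
    u ^ 12 * disc W′          ≡⟨ disc-scale u W′ ⟨
    disc (scale u W′)         ≡⟨ cong disc W′ᵘ≡Wʳˢᵗ ⟩
    disc (translate r s t W)  ≡⟨ disc-translate r s t W ⟩
    disc W                    ∎

*-cancelʳ-≢0 : ∀ p q r → ¬ (r ≡ 0ℚ) → p * r ≡ q * r → p ≡ q
*-cancelʳ-≢0 p q r r≢0 pr≡qr = begin
  p              ≡⟨ *-identityʳ p ⟨
  p * 1ℚ         ≡⟨ cong (p *_) (*-inverseʳ r) ⟨
  p * (r * 1/r)  ≡⟨ *-assoc p r 1/r ⟨
  p * r * 1/r    ≡⟨ cong (_* 1/r) pr≡qr ⟩
  q * r * 1/r    ≡⟨ *-assoc q r 1/r ⟩
  q * (r * 1/r)  ≡⟨ cong (q *_) (*-inverseʳ r) ⟩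
  q * 1ℚ         ≡⟨ *-identityʳ q ⟩
  q              ∎
  where
  open ≡-Reasoning
  instance
    r-nonZero = ≢-nonZero r≢0
  1/r : ℚ
  1/r = 1/ r

*-cancelˡ-≢0 : ∀ p q r → ¬ (r ≡ 0ℚ) → r * p ≡ r * q → p ≡ q
*-cancelˡ-≢0 p q r r≢0 rp≡rq = *-cancelʳ-≢0 p q r r≢0 (trans (*-comm p r) (trans rp≡rq (*-comm r q)))

pos⇒≢0 : ∀ p → .{{Positive p}} → ¬ (p ≡ 0ℚ)
pos⇒≢0 p p≡0 = <-irrefl (sym p≡0) (positive⁻¹ p)

∣pos*q∣≡pos*∣q∣ : ∀ p .{{_ : Positive p}} q → ∣ p * q ∣ ≡ p * ∣ q ∣
∣pos*q∣≡pos*∣q∣ p q = trans (∣p*q∣≡∣p∣*∣q∣ p q) (cong (_* ∣ q ∣) (0≤p⇒∣p∣≡p (<⇒≤ (positive⁻¹ p))))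

≢0⇒p*p-pos : ∀ p → ¬ (p ≡ 0ℚ) → Positive (p * p)
≢0⇒p*p-pos p@(mkℚ +[1+ _ ] _ _) _ = pos*pos⇒pos p p
≢0⇒p*p-pos p@(mkℚ -[1+ _ ] _ _) _ = neg*neg⇒pos p p
≢0⇒p*p-pos p@(mkℚ +0 _ _)       p≢0 = ⊥-elim (p≢0 (↥p≡0⇒p≡0 p refl))

x³<y³ : ∀ x y → .{{Positive x}} → .{{Positive y}} → x < y → x * x * x < y * y * y
x³<y³ x y x<y = begin-strict
  x * x * x  <⟨ *-monoˡ-<-pos x (*-monoˡ-<-pos x x<y) ⟩
  y * x * x  <⟨ *-monoˡ-<-pos x (*-monoʳ-<-pos y x<y) ⟩
  y * y * x  <⟨ *-monoʳ-<-pos (y * y) {{pos*pos⇒pos y y}} x<y ⟩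
  y * y * y  ∎
  where open ≤-Reasoning

cube-injective : ∀ x y → .{{Positive x}} → .{{Positive y}} → x * x * x ≡ y * y * y → x ≡ y
cube-injective x y x³≡y³ with <-cmp x y
... | tri< x<y _ _ = ⊥-elim (<-irrefl x³≡y³ (x³<y³ x y x<y))
... | tri≈ _ x≡y _ = x≡y
... | tri> _ _ y<x = ⊥-elim (<-irrefl (sym x³≡y³) (x³<y³ y x y<x))

p^12≡p^4*p^4*p^4 : ∀ p → p ^ 12 ≡ p ^ 4 * p ^ 4 * p ^ 4
p^12≡p^4*p^4*p^4 = solve-∀ ℚ-ring

p^4≡p*p*[p*p] : ∀ p → p ^ 4 ≡ (p * p) * (p * p)
p^4≡p*p*[p*p] = solve-∀ ℚ-ring

≢0⇒p^4-pos : ∀ p → ¬ (p ≡ 0ℚ) → Positive (p ^ 4)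
≢0⇒p^4-pos p p≢0 = subst Positive (sym (p^4≡p*p*[p*p] p)) (pos*pos⇒pos (p * p) (p * p))
  where instance p²-pos = ≢0⇒p*p-pos p p≢0

≢0⇒p^12-pos : ∀ p → ¬ (p ≡ 0ℚ) → Positive (p ^ 12)
≢0⇒p^12-pos p p≢0 =
  subst Positive (sym (p^12≡p^4*p^4*p^4 p)) (pos*pos⇒pos (p ^ 4 * p ^ 4) {{pos*pos⇒pos (p ^ 4) (p ^ 4)}} (p ^ 4))
  where instance p⁴-pos = ≢0⇒p^4-pos p p≢0

p^12≡q^12⇒p^4≡q^4 : ∀ p q → ¬ (p ≡ 0ℚ) → ¬ (q ≡ 0ℚ) → p ^ 12 ≡ q ^ 12 → p ^ 4 ≡ q ^ 4
p^12≡q^12⇒p^4≡q^4 p q p≢0 q≢0 p¹²≡q¹² = cube-injective (p ^ 4) (q ^ 4) {{≢0⇒p^4-pos p p≢0}} {{≢0⇒p^4-pos q q≢0}}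
  (trans (sym (p^12≡p^4*p^4*p^4 p)) (trans p¹²≡q¹² (p^12≡p^4*p^4*p^4 q)))

globalMinimal-∣disc∣ : ∀ {E M M′} → GlobalMinimal E M → GlobalMinimal E M′ → ∣ disc M ∣ ≡ ∣ disc M′ ∣
globalMinimal-∣disc∣ {M = M} {M′} (integral , iso , minimal) (integral′ , iso′ , minimal′) =
  ≤-antisym (minimal M′ integral′ iso′) (minimal′ M integral iso)

globalMinimal-invariants : ∀ {E M M′} → GlobalMinimal E M → GlobalMinimal E M′ →
  (c4 M ≡ c4 M′) × (disc M ≡ disc M′)
globalMinimal-invariants {E} {M} {M′} gm@(_ , iso , _) gm′@(_ , iso′ , _) = c4-eq , disc-eq
  where
  open ScaledInvariants (isoQ⇒scaledInvariants {eqn E} {M} iso)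
  open ScaledInvariants (isoQ⇒scaledInvariants {eqn E} {M′} iso′)
    renaming (u to v; u≢0 to v≢0; c4-scaled to c4-scaled′; disc-scaled to disc-scaled′)
  u¹²-pos : Positive (u ^ 12)
  u¹²-pos = ≢0⇒p^12-pos u u≢0
  disc≢0 : ¬ (∣ disc M ∣ ≡ 0ℚ)
  disc≢0 ∣ΔM∣≡0 = nonsing E (begin
    disc (eqn E)       ≡⟨ disc-scaled ⟨
    u ^ 12 * disc M    ≡⟨ cong (u ^ 12 *_) (∣p∣≡0⇒p≡0 (disc M) ∣ΔM∣≡0) ⟩
    u ^ 12 * 0ℚ        ≡⟨ *-zeroʳ (u ^ 12) ⟩
    0ℚ                 ∎)
    where open ≡-Reasoning
  u¹²≡v¹² : u ^ 12 ≡ v ^ 12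
  u¹²≡v¹² = *-cancelʳ-≢0 (u ^ 12) (v ^ 12) ∣ disc M ∣ disc≢0 (begin
    u ^ 12 * ∣ disc M ∣    ≡⟨ ∣pos*q∣≡pos*∣q∣ (u ^ 12) {{u¹²-pos}} (disc M) ⟨
    ∣ u ^ 12 * disc M ∣    ≡⟨ cong ∣_∣ (trans disc-scaled (sym disc-scaled′)) ⟩
    ∣ v ^ 12 * disc M′ ∣   ≡⟨ ∣pos*q∣≡pos*∣q∣ (v ^ 12) {{≢0⇒p^12-pos v v≢0}} (disc M′) ⟩
    v ^ 12 * ∣ disc M′ ∣   ≡⟨ cong (v ^ 12 *_) (globalMinimal-∣disc∣ {E} {M′} {M} gm′ gm) ⟩
    v ^ 12 * ∣ disc M ∣    ∎)
    where open ≡-Reasoning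
  c4-eq : c4 M ≡ c4 M′
  c4-eq = *-cancelˡ-≢0 (c4 M) (c4 M′) (u ^ 4) (pos⇒≢0 (u ^ 4) {{≢0⇒p^4-pos u u≢0}})
    (trans c4-scaled (trans (sym c4-scaled′) (cong (_* c4 M′) (sym (p^12≡q^12⇒p^4≡q^4 u v u≢0 v≢0 u¹²≡v¹²)))))
  disc-eq : disc M ≡ disc M′
  disc-eq = *-cancelˡ-≢0 (disc M) (disc M′) (u ^ 12) (pos⇒≢0 (u ^ 12) {{u¹²-pos}})
    (trans disc-scaled (trans (sym disc-scaled′) (cong (_* disc M′) (sym u¹²≡v¹²))))

toℚᵘ-ι : ∀ z → toℚᵘ (ι z) ℚᵘ.≃ ℚᵘ.mkℚᵘ z 0
toℚᵘ-ι z = toℚᵘ-fromℚᵘ (ℚᵘ.mkℚᵘ z 0)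

ι-homo-+ : ∀ i j → ι (i ℤ.+ j) ≡ ι i + ι j
ι-homo-+ i j = toℚᵘ-injective (begin
  toℚᵘ (ι (i ℤ.+ j))                     ≈⟨ toℚᵘ-ι (i ℤ.+ j) ⟩
  ℚᵘ.mkℚᵘ (i ℤ.+ j) 0                    ≈⟨ ℚᵘ.*≡* ([i+j]*1≡[i*1+j*1]*1 i j) ⟩
  ℚᵘ.mkℚᵘ i 0 ℚᵘ.+ ℚᵘ.mkℚᵘ j 0          ≈⟨ ℚᵘ.+-cong (toℚᵘ-ι i) (toℚᵘ-ι j) ⟨
  toℚᵘ (ι i) ℚᵘ.+ toℚᵘ (ι j)             ≈⟨ toℚᵘ-homo-+ (ι i) (ι j) ⟨
  toℚᵘ (ι i + ι j)                       ∎)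
  where
  open ℚᵘ.≃-Reasoning
  [i+j]*1≡[i*1+j*1]*1 : ∀ i j → (i ℤ.+ j) ℤ.* + 1 ≡ (i ℤ.* + 1 ℤ.+ j ℤ.* + 1) ℤ.* + 1
  [i+j]*1≡[i*1+j*1]*1 = ℤ-solve-∀

ι-homo-* : ∀ i j → ι (i ℤ.* j) ≡ ι i * ι j
ι-homo-* i j = toℚᵘ-injective (begin
  toℚᵘ (ι (i ℤ.* j))                     ≈⟨ toℚᵘ-ι (i ℤ.* j) ⟩
  ℚᵘ.mkℚᵘ i 0 ℚᵘ.* ℚᵘ.mkℚᵘ j 0          ≈⟨ ℚᵘ.*-cong (toℚᵘ-ι i) (toℚᵘ-ι j) ⟨
  toℚᵘ (ι i) ℚᵘ.* toℚᵘ (ι j)             ≈⟨ toℚᵘ-homo-* (ι i) (ι j) ⟨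
  toℚᵘ (ι i * ι j)                       ∎)
  where open ℚᵘ.≃-Reasoning

ι-homo‿- : ∀ i → ι (ℤ.- i) ≡ - ι i
ι-homo‿- i = toℚᵘ-injective (begin
  toℚᵘ (ι (ℤ.- i))        ≈⟨ toℚᵘ-ι (ℤ.- i) ⟩
  ℚᵘ.- ℚᵘ.mkℚᵘ i 0        ≈⟨ ℚᵘ.-‿cong (toℚᵘ-ι i) ⟨
  ℚᵘ.- toℚᵘ (ι i)         ≈⟨ toℚᵘ-homo‿- (ι i) ⟨
  toℚᵘ (- ι i)            ∎)
  where open ℚᵘ.≃-Reasoning

ι-injective : ∀ {i j} → ι i ≡ ι j → i ≡ j
ι-injective {i} {j} ιi≡ιj with mkℚᵘi≃mkℚᵘj
  where
  open ℚᵘ.≃-Reasoning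
  mkℚᵘi≃mkℚᵘj : ℚᵘ.mkℚᵘ i 0 ℚᵘ.≃ ℚᵘ.mkℚᵘ j 0
  mkℚᵘi≃mkℚᵘj = begin
    ℚᵘ.mkℚᵘ i 0   ≈⟨ toℚᵘ-ι i ⟨
    toℚᵘ (ι i)    ≈⟨ toℚᵘ-cong ιi≡ιj ⟩
    toℚᵘ (ι j)    ≈⟨ toℚᵘ-ι j ⟩
    ℚᵘ.mkℚᵘ j 0   ∎
... | ℚᵘ.*≡* i*1≡j*1 = trans (sym (ℤ.*-identityʳ i)) (trans i*1≡j*1 (ℤ.*-identityʳ j))

infixl 6 _+ᴵ_ _-ᴵ_
infixl 7 _*ᴵ_

κᴵ : ∀ n → IsInt (κ n)
κᴵ n = + n , refl

_+ᴵ_ : ∀ {p q} → IsInt p → IsInt q → IsInt (p + q)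
(i , refl) +ᴵ (j , refl) = i ℤ.+ j , sym (ι-homo-+ i j)

_*ᴵ_ : ∀ {p q} → IsInt p → IsInt q → IsInt (p * q)
(i , refl) *ᴵ (j , refl) = i ℤ.* j , sym (ι-homo-* i j)

-ᴵ_ : ∀ {p} → IsInt p → IsInt (- p)
-ᴵ (i , refl) = ℤ.- i , sym (ι-homo‿- i)

_-ᴵ_ : ∀ {p q} → IsInt p → IsInt q → IsInt (p - q)
p-int -ᴵ q-int = p-int +ᴵ -ᴵ q-int

∣ℚ-ι⇒∣ : ∀ {p z} → p ∣ℚ ι z → + p ∣ z
∣ℚ-ι⇒∣ {p} (k , ιz≡ι[pk]) = divides k (trans (ι-injective ιz≡ι[pk]) (ℤ.*-comm (+ p) k))

2∣ℚ-even : ∀ {q} → IsInt q → 2 ∣ℚ (κ 2 * q)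
2∣ℚ-even (k , refl) = k , sym (ι-homo-* (+ 2) k)

2∤ℚ-odd : ∀ {q} → IsInt q → ¬ 2 ∣ℚ (κ 1 + κ 2 * q)
2∤ℚ-odd (k , refl) 2∣1+2k = 2≢1 (∣1⇒≡1 (∣⇒∣ᵤ 2∣1))
  where
  2≢1 : ¬ (2 ≡ 1)
  2≢1 ()
  ι[1+2k]≡1+2ιk : ι (+ 1 ℤ.+ + 2 ℤ.* k) ≡ κ 1 + κ 2 * ι k
  ι[1+2k]≡1+2ιk = trans (ι-homo-+ (+ 1) (+ 2 ℤ.* k)) (cong (_+_ (κ 1)) (ι-homo-* (+ 2) k))
  2∣1 : + 2 ∣ + 1
  2∣1 = ∣m+n∣n⇒∣m (∣ℚ-ι⇒∣ (subst (2 ∣ℚ_) (sym ι[1+2k]≡1+2ιk) 2∣1+2k)) (divides k (ℤ.*-comm (+ 2) k))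

a₁≡1⇒¬2∣c4 : ∀ W → Integral W → a1 W ≡ κ 1 → ¬ 2 ∣ℚ c4 W
a₁≡1⇒¬2∣c4 (mkW _ x₂ x₃ x₄ _) (_ , i₂ , i₃ , i₄ , _) refl =
  2∤ℚ-odd (κᴵ 4 *ᴵ i₂ -ᴵ κᴵ 12 *ᴵ i₃ +ᴵ κᴵ 8 *ᴵ i₂ *ᴵ i₂ -ᴵ κᴵ 24 *ᴵ i₄) ∘ subst (2 ∣ℚ_) (c4-odd x₂ x₃ x₄)
  where
  c4-odd : ∀ x₂ x₃ x₄ →
    let x₁ = κ 1
    in x₁ * x₁ * x₁ * x₁ + κ 8 * x₁ * x₁ * x₂ - κ 24 * x₁ * x₃ + κ 16 * x₂ * x₂ - κ 48 * x₄
       ≡ κ 1 + κ 2 * (κ 4 * x₂ - κ 12 * x₃ + κ 8 * x₂ * x₂ - κ 24 * x₄)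
  c4-odd = solve-∀ ℚ-ring

a₁≡0⇒a₃≡1⇒¬2∣disc : ∀ W → Integral W → a1 W ≡ κ 0 → a3 W ≡ κ 1 → ¬ 2 ∣ℚ disc W
a₁≡0⇒a₃≡1⇒¬2∣disc (mkW _ x₂ _ x₄ x₆) (_ , i₂ , _ , i₄ , i₆) refl refl =
  2∤ℚ-odd (i₂ *ᴵ i₂ *ᴵ (κᴵ 8 *ᴵ i₄ *ᴵ i₄ -ᴵ κᴵ 32 *ᴵ i₂ *ᴵ i₆ -ᴵ κᴵ 8 *ᴵ i₂) -ᴵ κᴵ 32 *ᴵ i₄ *ᴵ i₄ *ᴵ i₄
           -ᴵ κᴵ 14 -ᴵ κᴵ 108 *ᴵ i₆ -ᴵ κᴵ 216 *ᴵ i₆ *ᴵ i₆ +ᴵ κᴵ 36 *ᴵ i₂ *ᴵ i₄ +ᴵ κᴵ 144 *ᴵ i₂ *ᴵ i₄ *ᴵ i₆)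
  ∘ subst (2 ∣ℚ_) (disc-odd x₂ x₄ x₆)
  where
  disc-odd : ∀ x₂ x₄ x₆ →
    let x₁ = κ 0
        x₃ = κ 1
        Δ = λ b₂ b₄ b₆ b₈ → - (b₂ * b₂ * b₈) - κ 8 * b₄ * b₄ * b₄ - κ 27 * b₆ * b₆ + κ 9 * b₂ * b₄ * b₆
    in Δ (x₁ * x₁ + κ 4 * x₂) (κ 2 * x₄ + x₁ * x₃) (x₃ * x₃ + κ 4 * x₆)
         (x₁ * x₁ * x₆ + κ 4 * x₂ * x₆ - x₁ * x₃ * x₄ + x₂ * x₃ * x₃ - x₄ * x₄)
       ≡ κ 1 + κ 2 * (x₂ * x₂ * (κ 8 * x₄ * x₄ - κ 32 * x₂ * x₆ - κ 8 * x₂) - κ 32 * x₄ * x₄ * x₄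
                 - κ 14 - κ 108 * x₆ - κ 216 * x₆ * x₆ + κ 36 * x₂ * x₄ + κ 144 * x₂ * x₄ * x₆)
  disc-odd = solve-∀ ℚ-ring

a₁≡0⇒a₃≡0⇒2∣c4 : ∀ W → Integral W → a1 W ≡ κ 0 → a3 W ≡ κ 0 → 2 ∣ℚ c4 W
a₁≡0⇒a₃≡0⇒2∣c4 (mkW _ x₂ _ x₄ _) (_ , i₂ , _ , i₄ , _) refl refl =
  subst (2 ∣ℚ_) (sym (c4-even x₂ x₄)) (2∣ℚ-even (κᴵ 8 *ᴵ i₂ *ᴵ i₂ -ᴵ κᴵ 24 *ᴵ i₄))
  where
  c4-even : ∀ x₂ x₄ →
    let x₁ = κ 0
        x₃ = κ 0
    in x₁ * x₁ * x₁ * x₁ + κ 8 * x₁ * x₁ * x₂ - κ 24 * x₁ * x₃ + κ 16 * x₂ * x₂ - κ 48 * x₄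
       ≡ κ 2 * (κ 8 * x₂ * x₂ - κ 24 * x₄)
  c4-even = solve-∀ ℚ-ring

a₁≡0⇒a₃≡0⇒2∣disc : ∀ W → Integral W → a1 W ≡ κ 0 → a3 W ≡ κ 0 → 2 ∣ℚ disc W
a₁≡0⇒a₃≡0⇒2∣disc (mkW _ x₂ _ x₄ x₆) (_ , i₂ , _ , i₄ , i₆) refl refl =
  subst (2 ∣ℚ_) (sym (disc-even x₂ x₄ x₆))
    (2∣ℚ-even (i₂ *ᴵ i₂ *ᴵ (κᴵ 8 *ᴵ i₄ *ᴵ i₄ -ᴵ κᴵ 32 *ᴵ i₂ *ᴵ i₆) -ᴵ κᴵ 32 *ᴵ i₄ *ᴵ i₄ *ᴵ i₄
               -ᴵ κᴵ 216 *ᴵ i₆ *ᴵ i₆ +ᴵ κᴵ 144 *ᴵ i₂ *ᴵ i₄ *ᴵ i₆))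
  where
  disc-even : ∀ x₂ x₄ x₆ →
    let x₁ = κ 0
        x₃ = κ 0
        Δ = λ b₂ b₄ b₆ b₈ → - (b₂ * b₂ * b₈) - κ 8 * b₄ * b₄ * b₄ - κ 27 * b₆ * b₆ + κ 9 * b₂ * b₄ * b₆
    in Δ (x₁ * x₁ + κ 4 * x₂) (κ 2 * x₄ + x₁ * x₃) (x₃ * x₃ + κ 4 * x₆)
         (x₁ * x₁ * x₆ + κ 4 * x₂ * x₆ - x₁ * x₃ * x₄ + x₂ * x₃ * x₃ - x₄ * x₄)
       ≡ κ 2 * (x₂ * x₂ * (κ 8 * x₄ * x₄ - κ 32 * x₂ * x₆) - κ 32 * x₄ * x₄ * x₄
           - κ 216 * x₆ * x₆ + κ 144 * x₂ * x₄ * x₆)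
  disc-even = solve-∀ ℚ-ring

2∣c4⇒2∣disc⇒a₁≡0∧a₃≡0 : ∀ W → Integral W → (a1 W ≡ κ 0 ⊎ a1 W ≡ κ 1) → (a3 W ≡ κ 0 ⊎ a3 W ≡ κ 1) →
  2 ∣ℚ c4 W → 2 ∣ℚ disc W → (a1 W ≡ κ 0) × (a3 W ≡ κ 0)
2∣c4⇒2∣disc⇒a₁≡0∧a₃≡0 W int (inj₂ a₁≡1) _            2∣c4 _      = ⊥-elim (a₁≡1⇒¬2∣c4 W int a₁≡1 2∣c4)
2∣c4⇒2∣disc⇒a₁≡0∧a₃≡0 W int (inj₁ a₁≡0) (inj₂ a₃≡1) _    2∣disc = ⊥-elim (a₁≡0⇒a₃≡1⇒¬2∣disc W int a₁≡0 a₃≡1 2∣disc)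
2∣c4⇒2∣disc⇒a₁≡0∧a₃≡0 W int (inj₁ a₁≡0) (inj₁ a₃≡0) _    _      = a₁≡0 , a₃≡0

RmmInR₁R₃R₅ : Weierstrass → Set
RmmInR₁R₃R₅ M = RmmIs M (κ 0) (κ 0) (κ 0) ⊎ RmmIs M (κ 0) (- κ 1) (κ 0) ⊎ RmmIs M (κ 0) (κ 1) (κ 0)

rmmInR₁R₃R₅⇒a₁≡0∧a₃≡0 : ∀ {M} → RmmInR₁R₃R₅ M → (a1 M ≡ κ 0) × (a3 M ≡ κ 0)
rmmInR₁R₃R₅⇒a₁≡0∧a₃≡0 (inj₁ (a₁≡0 , _ , a₃≡0))        = a₁≡0 , a₃≡0
rmmInR₁R₃R₅⇒a₁≡0∧a₃≡0 (inj₂ (inj₁ (a₁≡0 , _ , a₃≡0))) = a₁≡0 , a₃≡0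
rmmInR₁R₃R₅⇒a₁≡0∧a₃≡0 (inj₂ (inj₂ (a₁≡0 , _ , a₃≡0))) = a₁≡0 , a₃≡0

a₁≡0⇒a₃≡0⇒rmmInR₁R₃R₅ : ∀ {M} → (a2 M ≡ - κ 1 ⊎ a2 M ≡ κ 0 ⊎ a2 M ≡ κ 1) →
  a1 M ≡ κ 0 → a3 M ≡ κ 0 → RmmInR₁R₃R₅ M
a₁≡0⇒a₃≡0⇒rmmInR₁R₃R₅ (inj₁ a₂≡-1)        a₁≡0 a₃≡0 = inj₂ (inj₁ (a₁≡0 , a₂≡-1 , a₃≡0))
a₁≡0⇒a₃≡0⇒rmmInR₁R₃R₅ (inj₂ (inj₁ a₂≡0)) a₁≡0 a₃≡0 = inj₁ (a₁≡0 , a₂≡0 , a₃≡0)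
a₁≡0⇒a₃≡0⇒rmmInR₁R₃R₅ (inj₂ (inj₂ a₂≡1)) a₁≡0 a₃≡0 = inj₂ (inj₂ (a₁≡0 , a₂≡1 , a₃≡0))

corollaryC : (E : EllipticCurve) (M : Weierstrass) → ReducedMinimal E M →
    (AdditiveAt 2 E → RmmIs M (κ 0) (κ 0) (κ 0) ⊎ RmmIs M (κ 0) (- κ 1) (κ 0) ⊎ RmmIs M (κ 0) (κ 1) (κ 0))
    × (RmmIs M (κ 0) (κ 0) (κ 0) ⊎ RmmIs M (κ 0) (- κ 1) (κ 0) ⊎ RmmIs M (κ 0) (κ 1) (κ 0) → AdditiveAt 2 E)
corollaryC E M (gm@(int , _) , a₁∈ , a₃∈ , a₂∈) = additive⇒rmm , rmm⇒additive
  where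
  additive⇒rmm : AdditiveAt 2 E → RmmInR₁R₃R₅ M
  additive⇒rmm (M′ , gm′ , 2∣c4′ , 2∣disc′) =
    uncurry (a₁≡0⇒a₃≡0⇒rmmInR₁R₃R₅ {M} a₂∈) (2∣c4⇒2∣disc⇒a₁≡0∧a₃≡0 M int a₁∈ a₃∈ 2∣c4 2∣disc)
    where
    invariants : (c4 M ≡ c4 M′) × (disc M ≡ disc M′)
    invariants = globalMinimal-invariants {E} {M} {M′} gm gm′
    2∣c4 : 2 ∣ℚ c4 M
    2∣c4 = subst (2 ∣ℚ_) (sym (proj₁ invariants)) 2∣c4′
    2∣disc : 2 ∣ℚ disc M
    2∣disc = subst (2 ∣ℚ_) (sym (proj₂ invariants)) 2∣disc′
  rmm⇒additive : RmmInR₁R₃R₅ M → AdditiveAt 2 E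
  rmm⇒additive rmm = M , gm , uncurry (a₁≡0⇒a₃≡0⇒2∣c4 M int) a₁a₃≡0 , uncurry (a₁≡0⇒a₃≡0⇒2∣disc M int) a₁a₃≡0
    where
    a₁a₃≡0 : (a1 M ≡ κ 0) × (a3 M ≡ κ 0)
    a₁a₃≡0 = rmmInR₁R₃R₅⇒a₁≡0∧a₃≡0 {M} rmm
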